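{- Let $C_n$ denote the cycle of order $n$. Then $n_\mathscr{D}(C_3)=2$, $n_\mathscr{D}(C_4)=6$, $n_\mathscr{D}(C_5)=12$, $n_\mathscr{D}(C_6)=20$, and, for $n\geq 7$, $$n_\mathscr{D}(C_n)=2n_\mathscr{D}(C_{n-1})-n_\mathscr{D}(C_{n-2})+n_\mathscr{D}(C_{n-4}).$$
   Context: For a graph $G$ and $v\in V(G)$, $N[v]$ is the closed neighbourhood of $v$ (the neighbours of $v$ together with $v$), and for $S\subseteq V(G)$, $N[S]=\bigcup_{v\in S}N[v]$. A set $S\subseteq V(G)$ is digitally convex if for every $v\in V(G)$, $N[v]\subseteq N[S]$ implies $v\in S$ (in particular $\emptyset$ and $V(G)$ are digitally convex). $n_\mathscr{D}(G)$ denotes the number of digitally convex subsets of $V(G)$. -}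

module Defs where

open import Data.Nat using (ℕ; zero; suc; _+_; _∸_; _*_)
open import Data.Fin using (Fin; toℕ)
open import Data.Fin.Properties using (all?; any?; _≟_)
open import Data.Fin.Subset using (Subset; _∈_; ⊥; ⊤)
open import Data.Fin.Subset.Properties using (_∈?_)
open import Data.Vec using (Vec; []; _∷_)
open import Data.Bool using (Bool; true; false)
open import Data.List using (List; []; _∷_; map; _++_; filter; length)
open import Data.Product using (∃; _×_; _,_)
open import Data.Sum using (_⊎_)
open import Data.Nat.DivMod using (_%_)
open import Relation.Binary.PropositionalEquality using (_≡_)
open import Relation.Nullary using (Dec; yes; no; ¬_)
open import Relation.Nullary.Decidable using (_×-dec_; _⊎-dec_; _→-dec_)
open import Relation.Unary using (Decidable)
import Data.Nat.Properties as ℕP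

record Graph (n : ℕ) : Set₁ where
  field
    Adj    : Fin n → Fin n → Set
    adj?   : ∀ u v → Dec (Adj u v)

open Graph public

InN : ∀ {n} (G : Graph n) → Fin n → Fin n → Set
InN G v u = (u ≡ v) ⊎ Adj G v u

inN? : ∀ {n} (G : Graph n) v u → Dec (InN G v u)
inN? G v u = (u ≟ v) ⊎-dec adj? G v u

InNS : ∀ {n} (G : Graph n) → Subset n → Fin n → Set
InNS G S u = ∃ λ s → s ∈ S × InN G s u

inNS? : ∀ {n} (G : Graph n) S u → Dec (InNS G S u)
inNS? G S u = any? λ s → (s ∈? S) ×-dec inN? G s u

DigitallyConvex : ∀ {n} (G : Graph n) → Subset n → Set
DigitallyConvex {n} G S =
  (v : Fin n) → ((u : Fin n) → InN G v u → InNS G S u) → v ∈ S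

digitallyConvex? : ∀ {n} (G : Graph n) → Decidable (DigitallyConvex G)
digitallyConvex? G S =
  all? λ v → (all? λ u → inN? G v u →-dec inNS? G S u) →-dec (v ∈? S)

allSubsets : (n : ℕ) → List (Subset n)
allSubsets zero    = [] ∷ []
allSubsets (suc n) = map (true ∷_) (allSubsets n) ++ map (false ∷_) (allSubsets n)

nD : ∀ {n} → Graph n → ℕ
nD {n} G = length (filter (digitallyConvex? G) (allSubsets n))

-- The cycle C_n on vertices 0,…,n-1: i ~ j iff j ≡ i+1 (mod n) or i ≡ j+1 (mod n).
-- (Only used for n ≥ 3, where this is the simple cycle of order n.)
CycleAdj : ∀ n → Fin n → Fin n → Set
CycleAdj n i j = ((toℕ j ≡ (suc (toℕ i)) % suc (n ∸ 1)) ⊎ (toℕ i ≡ (suc (toℕ j)) % suc (n ∸ 1)))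

C : (n : ℕ) → Graph n
C n = record
  { Adj  = CycleAdj n
  ; adj? = λ i j → (toℕ j ℕP.≟ (suc (toℕ i)) % suc (n ∸ 1)) ⊎-dec (toℕ i ℕP.≟ (suc (toℕ j)) % suc (n ∸ 1))
  }

-- In any finite graph, S is digitally convex iff every vertex v is accounted
-- for: v ∈ S, or some u ∈ N[v] lies outside N[S].  On a cycle N[v] is
-- {v-1, v, v+1}, so whether v is accounted for depends only on the five bits
-- of S at v-2, …, v+2, through a fixed Boolean test `window`.  Writing
-- S = q R with q its first four bits, S is convex iff every five consecutive
-- bits of the linear word q R q pass the test.  Hence n_D(C_{4+m}) =
-- Σ_q T m q q, where the transfer count T m q z is the number of words R of
-- length m for which q R z passes every window.  Splitting off the first bit
-- of R expresses T (suc m) linearly through T m, so the identity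
-- T(4+j) + T(2+j) = 2 T(3+j) + T(j), checked by computation at j = 0 for
-- all 256 boundary pairs (q, z), holds for every j; summing gives the
-- recurrence for n_D.  The values for n ≤ 7 are computed.

module Submission where

open import Defs
open import Data.Nat using (ℕ; _+_; _∸_; _*_; _≥_)
open import Data.Product using (_×_)
open import Relation.Binary.PropositionalEquality using (_≡_)

open import Data.Nat using (zero; suc; _<_; _≤_; z≤n; s≤s; _%_)
open import Data.Nat.Properties
  using (_≟_; _<?_; ≮⇒≥; +-comm; +-suc; *-identityˡ; *-distribˡ-+;
         +-cancelˡ-<; +-cancelˡ-≤; +-monoʳ-≤; +-mono-≤-<; m≤n⇒∃[o]m+o≡n; m≤n⇒m<n∨m≡n;
         ≤-trans; m≤m+n)
open import Data.Nat.DivMod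
  using (_mod_; m%n<n; m%n%n≡m%n; [m+n]%n≡m%n; %-distribˡ-+; %-congˡ; m<n⇒m%n≡m)
open import Data.Nat.ListAction using (sum)
open import Data.Nat.ListAction.Properties using (sum-++)
open import Data.Nat.Tactic.RingSolver using (solve-∀)
open import Data.Bool using (Bool; true; false; _∧_; _∨_; not)
open import Data.Bool.Properties using (¬-not)
open import Data.Fin using (Fin; toℕ; fromℕ<)
open import Data.Fin.Properties using (toℕ-fromℕ<; toℕ-injective; toℕ<n; ¬∀⟶∃¬)
open import Data.Fin.Subset using (Subset; _∈_)
open import Data.Fin.Subset.Properties using (_∈?_)
open import Data.List using (List; []; _∷_; _++_; map; filter; length)
open import Data.List.Properties using (map-++; map-∘; length-++; ++-assoc)
open import Data.Vec using (Vec; []; _∷_; lookup; toList) renaming (_++_ to _++ᵛ_)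
open import Data.Vec.Properties using ([]=⇒lookup; lookup⇒[]=; length-toList; toList-++)
open import Data.Product using (∃; _,_; proj₁; proj₂)
open import Data.Sum using (_⊎_; inj₁; inj₂)
open import Data.Empty using (⊥-elim)
open import Function using (_∘_; _⇔_; mk⇔; Equivalence)
import Function.Properties.Equivalence as ⇔
open import Relation.Binary.PropositionalEquality
  using (refl; sym; trans; cong; cong₂; subst; module ≡-Reasoning)
open import Relation.Nullary using (Dec; yes; no; ¬_; does; contradiction)
open import Relation.Nullary.Decidable using (_→-dec_; _×-dec_; map′; decidable-stable; from-yes)
open import Relation.Unary using (Pred; Decidable)
open import Level using (0ℓ)

open Equivalence using (to; from)

𝟙 : Bool → ℕ
𝟙 true  = 1
𝟙 false = 0

𝟙-∧ : ∀ x y → 𝟙 (x ∧ y) ≡ 𝟙 x * 𝟙 y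
𝟙-∧ true  y = sym (*-identityˡ (𝟙 y))
𝟙-∧ false y = refl

Σᵛ : ∀ k → (Vec Bool k → ℕ) → ℕ
Σᵛ zero    f = f []
Σᵛ (suc k) f = Σᵛ k (λ v → f (true ∷ v)) + Σᵛ k (λ v → f (false ∷ v))

Σᵛ-cong : ∀ k {f g : Vec Bool k → ℕ} → (∀ v → f v ≡ g v) → Σᵛ k f ≡ Σᵛ k g
Σᵛ-cong zero    f≗g = f≗g []
Σᵛ-cong (suc k) f≗g =
  cong₂ _+_ (Σᵛ-cong k (f≗g ∘ (true ∷_))) (Σᵛ-cong k (f≗g ∘ (false ∷_)))

Σᵛ-*ˡ : ∀ k c (f : Vec Bool k → ℕ) → Σᵛ k (λ v → c * f v) ≡ c * Σᵛ k f
Σᵛ-*ˡ zero    c f = refl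
Σᵛ-*ˡ (suc k) c f = trans
  (cong₂ _+_ (Σᵛ-*ˡ k c (f ∘ (true ∷_))) (Σᵛ-*ˡ k c (f ∘ (false ∷_))))
  (sym (*-distribˡ-+ c _ _))

Σᵛ-++ : ∀ k m (f : Vec Bool (k + m) → ℕ) →
        Σᵛ (k + m) f ≡ Σᵛ k (λ q → Σᵛ m (λ R → f (q ++ᵛ R)))
Σᵛ-++ zero    m f = refl
Σᵛ-++ (suc k) m f =
  cong₂ _+_ (Σᵛ-++ k m (f ∘ (true ∷_))) (Σᵛ-++ k m (f ∘ (false ∷_)))

Σᵛ-allSubsets : ∀ k (f : Vec Bool k → ℕ) → sum (map f (allSubsets k)) ≡ Σᵛ k f
Σᵛ-allSubsets zero    f = +-comm (f []) 0
Σᵛ-allSubsets (suc k) f = begin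
  sum (map f (map (true ∷_) A ++ map (false ∷_) A))
    ≡⟨ cong sum (map-++ f (map (true ∷_) A) (map (false ∷_) A)) ⟩
  sum (map f (map (true ∷_) A) ++ map f (map (false ∷_) A))
    ≡⟨ sum-++ (map f (map (true ∷_) A)) (map f (map (false ∷_) A)) ⟩
  sum (map f (map (true ∷_) A)) + sum (map f (map (false ∷_) A))
    ≡⟨ cong₂ _+_ (cong sum (sym (map-∘ A))) (cong sum (sym (map-∘ A))) ⟩
  sum (map (f ∘ (true ∷_)) A) + sum (map (f ∘ (false ∷_)) A)
    ≡⟨ cong₂ _+_ (Σᵛ-allSubsets k (f ∘ (true ∷_))) (Σᵛ-allSubsets k (f ∘ (false ∷_))) ⟩
  Σᵛ (suc k) f ∎
  where open ≡-Reasoning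
        A = allSubsets k

length-filter : ∀ {A : Set} {P : Pred A 0ℓ} (P? : Decidable P) (xs : List A) →
                length (filter P? xs) ≡ sum (map (λ x → 𝟙 (does (P? x))) xs)
length-filter P? []       = refl
length-filter P? (x ∷ xs) with does (P? x)
... | true  = cong suc (length-filter P? xs)
... | false = length-filter P? xs

count-convex : ∀ {n} (G : Graph n) → nD G ≡ Σᵛ n (λ S → 𝟙 (does (digitallyConvex? G S)))
count-convex {n} G =
  trans (length-filter (digitallyConvex? G) (allSubsets n)) (Σᵛ-allSubsets n _)

does-≡ : ∀ {P : Set} {b : Bool} (P? : Dec P) → P ⇔ (b ≡ true) → does P? ≡ b
does-≡             (yes p) P⇔b = sym (to P⇔b p)
does-≡ {b = true}  (no ¬p) P⇔b = ⊥-elim (¬p (from P⇔b refl))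
does-≡ {b = false} (no _)  _   = refl

Step : (ℕ → ℕ) → ℕ → Set
Step f j = f (4 + j) + f (2 + j) ≡ 2 * f (3 + j) + f j

step-ext : ∀ f g j → (∀ i → f i ≡ g i) → Step g j → Step f j
step-ext f g j f≗g step = trans (cong₂ _+_ (f≗g (4 + j)) (f≗g (2 + j)))
  (trans step (sym (cong₂ (λ a b → 2 * a + b) (f≗g (3 + j)) (f≗g j))))

step-+ : ∀ f g j → Step f j → Step g j → Step (λ i → f i + g i) j
step-+ f g j sf sg = begin
  (f (4 + j) + g (4 + j)) + (f (2 + j) + g (2 + j))
    ≡⟨ interchange (f (4 + j)) (g (4 + j)) (f (2 + j)) (g (2 + j)) ⟩
  (f (4 + j) + f (2 + j)) + (g (4 + j) + g (2 + j))
    ≡⟨ cong₂ _+_ sf sg ⟩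
  (2 * f (3 + j) + f j) + (2 * g (3 + j) + g j)
    ≡⟨ regroup (f (3 + j)) (f j) (g (3 + j)) (g j) ⟩
  2 * (f (3 + j) + g (3 + j)) + (f j + g j) ∎
  where
  open ≡-Reasoning
  interchange : ∀ a b c d → (a + b) + (c + d) ≡ (a + c) + (b + d)
  interchange = solve-∀
  regroup : ∀ a b c d → (2 * a + b) + (2 * c + d) ≡ 2 * (a + c) + (b + d)
  regroup = solve-∀

step-* : ∀ c f j → Step f j → Step (λ i → c * f i) j
step-* c f j sf = begin
  c * f (4 + j) + c * f (2 + j)   ≡⟨ *-distribˡ-+ c (f (4 + j)) (f (2 + j)) ⟨
  c * (f (4 + j) + f (2 + j))     ≡⟨ cong (c *_) sf ⟩
  c * (2 * f (3 + j) + f j)       ≡⟨ distribute c (f (3 + j)) (f j) ⟩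
  2 * (c * f (3 + j)) + c * f j   ∎
  where
  open ≡-Reasoning
  distribute : ∀ c a b → c * (2 * a + b) ≡ 2 * (c * a) + c * b
  distribute = solve-∀

step-Σᵛ : ∀ k (F : Vec Bool k → ℕ → ℕ) j →
          (∀ v → Step (F v) j) → Step (λ i → Σᵛ k (λ v → F v i)) j
step-Σᵛ zero    F j steps = steps []
step-Σᵛ (suc k) F j steps = step-+ (Σᵛ-at true) (Σᵛ-at false) j
  (step-Σᵛ k (λ v → F (true ∷ v)) j (steps ∘ (true ∷_)))
  (step-Σᵛ k (λ v → F (false ∷ v)) j (steps ∘ (false ∷_)))
  where
  Σᵛ-at : Bool → ℕ → ℕ
  Σᵛ-at x i = Σᵛ k (λ v → F (x ∷ v) i)

window : Bool → Bool → Bool → Bool → Bool → Bool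
window a b c d e =
  c ∨ (not a ∧ not b ∧ not c) ∨ (not b ∧ not c ∧ not d) ∨ (not c ∧ not d ∧ not e)

data WindowCase (a b c d e : Bool) : Set where
  centre : c ≡ true → WindowCase a b c d e
  left   : a ≡ false → b ≡ false → c ≡ false → WindowCase a b c d e
  middle : b ≡ false → c ≡ false → d ≡ false → WindowCase a b c d e
  right  : c ≡ false → d ≡ false → e ≡ false → WindowCase a b c d e

window-complete : ∀ {a b c d e} → WindowCase a b c d e → window a b c d e ≡ true
window-complete                 (centre refl)           = refl
window-complete                 (left refl refl refl)   = refl
window-complete {true}          (middle refl refl refl) = refl
window-complete {false}         (middle refl refl refl) = refl
window-complete {true}  {true}  (right refl refl refl)  = refl
window-complete {true}  {false} (right refl refl refl)  = refl
window-complete {false} {true}  (right refl refl refl)  = refl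
window-complete {false} {false} (right refl refl refl)  = refl

window-sound : ∀ a b c d e → window a b c d e ≡ true → WindowCase a b c d e
window-sound a     b     true  d     e     _ = centre refl
window-sound false false false d     e     _ = left refl refl refl
window-sound true  false false false e     _ = middle refl refl refl
window-sound false true  false false false _ = right refl refl refl
window-sound true  true  false false false _ = right refl refl refl
window-sound true  true  false false true  ()
window-sound true  true  false true  e     ()
window-sound false true  false false true  ()
window-sound false true  false true  e     ()
window-sound true  false false true  e     ()

window-cong : ∀ {a a′ b b′ c c′ d d′ e e′} → a ≡ a′ → b ≡ b′ → c ≡ c′ → d ≡ d′ → e ≡ e′ →
              window a b c d e ≡ window a′ b′ c′ d′ e′
window-cong refl refl refl refl refl = refl

windowAt : (ℕ → Bool) → ℕ → Bool
windowAt f j = window (f j) (f (1 + j)) (f (2 + j)) (f (3 + j)) (f (4 + j))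

windowAt-cong : ∀ {f g : ℕ → Bool} j → (∀ i → i ≤ 4 → f (i + j) ≡ g (i + j)) →
                windowAt f j ≡ windowAt g j
windowAt-cong j f≗g = window-cong
  (f≗g 0 z≤n) (f≗g 1 (s≤s z≤n)) (f≗g 2 (s≤s (s≤s z≤n)))
  (f≗g 3 (s≤s (s≤s (s≤s z≤n)))) (f≗g 4 (s≤s (s≤s (s≤s (s≤s z≤n)))))

-- The i-th entry of a word (false past its end).
entry : List Bool → ℕ → Bool
entry []       _       = false
entry (x ∷ xs) zero    = x
entry (x ∷ xs) (suc i) = entry xs i

entry-++ˡ : ∀ xs ys i → i < length xs → entry (xs ++ ys) i ≡ entry xs i
entry-++ˡ (x ∷ xs) ys zero    _         = refl
entry-++ˡ (x ∷ xs) ys (suc i) (s≤s i<) = entry-++ˡ xs ys i i<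

entry-++ʳ : ∀ xs ys t → entry (xs ++ ys) (length xs + t) ≡ entry ys t
entry-++ʳ []       ys t = refl
entry-++ʳ (x ∷ xs) ys t = entry-++ʳ xs ys t

entry-toList : ∀ {n} (V : Vec Bool n) i (i<n : i < n) → entry (toList V) i ≡ lookup V (fromℕ< i<n)
entry-toList (x ∷ V) zero    _         = refl
entry-toList (x ∷ V) (suc i) (s≤s i<n) = entry-toList V i i<n

allWindows : List Bool → Bool
allWindows (a ∷ b ∷ c ∷ d ∷ e ∷ r) = window a b c d e ∧ allWindows (b ∷ c ∷ d ∷ e ∷ r)
allWindows _                       = true

∧-≡-true : ∀ x {y} → x ∧ y ≡ true → x ≡ true × y ≡ true
∧-≡-true true h = refl , h

∧-true-intro : ∀ {x y} → x ≡ true → y ≡ true → x ∧ y ≡ true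
∧-true-intro refl h = h

allWindows-sound : ∀ L → allWindows L ≡ true →
                   ∀ j → 5 + j ≤ length L → windowAt (entry L) j ≡ true
allWindows-sound (a ∷ b ∷ c ∷ d ∷ e ∷ r) h zero    _ = proj₁ (∧-≡-true _ h)
allWindows-sound (a ∷ b ∷ c ∷ d ∷ e ∷ r) h (suc j) (s≤s le) =
  allWindows-sound (b ∷ c ∷ d ∷ e ∷ r) (proj₂ (∧-≡-true (window a b c d e) h)) j le
allWindows-sound []                   h j ()
allWindows-sound (_ ∷ [])             h j (s≤s ())
allWindows-sound (_ ∷ _ ∷ [])         h j (s≤s (s≤s ()))
allWindows-sound (_ ∷ _ ∷ _ ∷ [])     h j (s≤s (s≤s (s≤s ())))
allWindows-sound (_ ∷ _ ∷ _ ∷ _ ∷ []) h j (s≤s (s≤s (s≤s (s≤s ()))))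

allWindows-complete : ∀ L → (∀ j → 5 + j ≤ length L → windowAt (entry L) j ≡ true) →
                      allWindows L ≡ true
allWindows-complete (a ∷ b ∷ c ∷ d ∷ e ∷ r) good = ∧-true-intro
  (good 0 (s≤s (s≤s (s≤s (s≤s (s≤s z≤n))))))
  (allWindows-complete (b ∷ c ∷ d ∷ e ∷ r) (λ j le → good (suc j) (s≤s le)))
allWindows-complete []                    _ = refl
allWindows-complete (_ ∷ [])              _ = refl
allWindows-complete (_ ∷ _ ∷ [])          _ = refl
allWindows-complete (_ ∷ _ ∷ _ ∷ [])      _ = refl
allWindows-complete (_ ∷ _ ∷ _ ∷ _ ∷ [])  _ = refl

Accounted : ∀ {n} → Graph n → Subset n → Fin n → Set
Accounted G S v = v ∈ S ⊎ ∃ λ u → InN G v u × ¬ InNS G S u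

-- S is convex iff every vertex is accounted for.  The forward direction finds
-- the witness u by a finite search, using that N[v] ⊆ N[S] is decidable.
convex⇔accounted : ∀ {n} (G : Graph n) S → DigitallyConvex G S ⇔ (∀ v → Accounted G S v)
convex⇔accounted G S = mk⇔ convex⇒accounted accounted⇒convex
  where
  convex⇒accounted : DigitallyConvex G S → ∀ v → Accounted G S v
  convex⇒accounted convex v with v ∈? S
  ... | yes v∈S = inj₁ v∈S
  ... | no  v∉S with ¬∀⟶∃¬ _ _ (λ u → inN? G v u →-dec inNS? G S u) (v∉S ∘ convex v)
  ...   | u , ¬[u∈N[v]⇒u∈N[S]] = inj₂ (u
          , decidable-stable (inN? G v u) (λ u∉N[v] → ¬[u∈N[v]⇒u∈N[S]] (λ u∈N[v] → contradiction u∈N[v] u∉N[v]))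
          , λ u∈N[S] → ¬[u∈N[v]⇒u∈N[S]] (λ _ → u∈N[S]))

  accounted⇒convex : (∀ v → Accounted G S v) → DigitallyConvex G S
  accounted⇒convex accounted v N[v]⊆N[S] with accounted v
  ... | inj₁ v∈S                   = v∈S
  ... | inj₂ (u , u∈N[v] , u∉N[S]) = contradiction (N[v]⊆N[S] u u∈N[v]) u∉N[S]

module Cycle (k : ℕ) where

  n : ℕ
  n = suc k

  pos : ℕ → Fin n
  pos j = j mod n

  toℕ-pos : ∀ j → toℕ (pos j) ≡ j % n
  toℕ-pos j = toℕ-fromℕ< (m%n<n j n)

  pos-% : ∀ i j → i % n ≡ j % n → pos i ≡ pos j
  pos-% i j eq = toℕ-injective (trans (toℕ-pos i) (trans eq (sym (toℕ-pos j))))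

  pos-toℕ : ∀ v → pos (toℕ v) ≡ v
  pos-toℕ v = toℕ-injective (trans (toℕ-pos (toℕ v)) (m<n⇒m%n≡m (toℕ<n v)))

  pos-wrap : ∀ j → pos (n + j) ≡ pos j
  pos-wrap j = pos-% (n + j) j (trans (%-congˡ (+-comm n j)) ([m+n]%n≡m%n j n))

  pos-shift : ∀ c j → pos (c + toℕ (pos j)) ≡ pos (c + j)
  pos-shift c j = pos-% (c + toℕ (pos j)) (c + j) (begin
    (c + toℕ (pos j)) % n      ≡⟨ %-congˡ (cong (c +_) (toℕ-pos j)) ⟩
    (c + j % n) % n            ≡⟨ %-distribˡ-+ c (j % n) n ⟩
    (c % n + j % n % n) % n    ≡⟨ cong (λ x → (c % n + x) % n) (m%n%n≡m%n j n) ⟩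
    (c % n + j % n) % n        ≡⟨ %-distribˡ-+ c j n ⟨
    (c + j) % n                ∎)
    where open ≡-Reasoning

  next prev : Fin n → Fin n
  next v = pos (1 + toℕ v)
  prev v = pos (k + toℕ v)

  next-pos : ∀ j → next (pos j) ≡ pos (suc j)
  next-pos = pos-shift 1

  prev-pos : ∀ j → prev (pos (suc j)) ≡ pos j
  prev-pos j = trans (pos-shift k (suc j)) (trans (cong pos (+-suc k j)) (pos-wrap j))

  next-prev : ∀ v → next (prev v) ≡ v
  next-prev v = trans (next-pos (k + toℕ v)) (trans (pos-wrap (toℕ v)) (pos-toℕ v))

  prev-next : ∀ v → prev (next v) ≡ v
  prev-next v = trans (prev-pos (toℕ v)) (pos-toℕ v)

  adj⇒next : ∀ {u v} → toℕ u ≡ suc (toℕ v) % n → u ≡ next v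
  adj⇒next {u} {v} eq = toℕ-injective (trans eq (sym (toℕ-pos (suc (toℕ v)))))

  N[_]-cases : ∀ v {u} → InN (C n) v u → u ≡ prev v ⊎ u ≡ v ⊎ u ≡ next v
  N[ v ]-cases (inj₁ u≡v)        = inj₂ (inj₁ u≡v)
  N[ v ]-cases (inj₂ (inj₁ adj)) = inj₂ (inj₂ (adj⇒next adj))
  N[ v ]-cases {u} (inj₂ (inj₂ adj)) =
    inj₁ (trans (sym (prev-next u)) (cong prev (sym (adj⇒next adj))))

  prev∈N : ∀ v → InN (C n) v (prev v)
  prev∈N v = inj₂ (inj₂ (trans (cong toℕ (sym (next-prev v))) (toℕ-pos (suc (toℕ (prev v))))))

  next∈N : ∀ v → InN (C n) v (next v)
  next∈N v = inj₂ (inj₁ (toℕ-pos (suc (toℕ v))))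

  N-sym : ∀ {v u} → InN (C n) v u → InN (C n) u v
  N-sym (inj₁ u≡v)        = inj₁ (sym u≡v)
  N-sym (inj₂ (inj₁ adj)) = inj₂ (inj₂ adj)
  N-sym (inj₂ (inj₂ adj)) = inj₂ (inj₁ adj)

  Uncovered : Subset n → Fin n → Set
  Uncovered S u = lookup S (prev u) ≡ false × lookup S u ≡ false × lookup S (next u) ≡ false

  uncovered⇔ : ∀ S u → (¬ InNS (C n) S u) ⇔ Uncovered S u
  uncovered⇔ S u = mk⇔
    (λ u∉N[S] → let absent = λ s s∈N → ¬-not (λ s∈S → u∉N[S] (s , lookup⇒[]= s S s∈S , s∈N)) in
       absent (prev u) (N-sym (prev∈N u)) , absent u (inj₁ refl) , absent (next u) (N-sym (next∈N u)))
    (λ { (p , c , nx) (s , s∈S , u∈N[s]) → absurd ([]=⇒lookup s∈S) p c nx (N[ u ]-cases (N-sym u∈N[s])) })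
    where
    true≢false : ∀ {x} → x ≡ true → x ≡ false → ∀ {A : Set} → A
    true≢false refl ()
    absurd : ∀ {s} → lookup S s ≡ true → lookup S (prev u) ≡ false → lookup S u ≡ false →
             lookup S (next u) ≡ false → s ≡ prev u ⊎ s ≡ u ⊎ s ≡ next u → ∀ {A : Set} → A
    absurd s∈S p c nx (inj₁ refl)        = true≢false s∈S p
    absurd s∈S p c nx (inj₂ (inj₁ refl)) = true≢false s∈S c
    absurd s∈S p c nx (inj₂ (inj₂ refl)) = true≢false s∈S nx

  centredWindow : Subset n → Fin n → Bool
  centredWindow S v = window (lookup S (prev (prev v))) (lookup S (prev v)) (lookup S v)
                             (lookup S (next v)) (lookup S (next (next v)))

  -- v is accounted for iff the window centred at v passes: each WindowCase
  -- other than `centre` names the vertex u ∈ N[v] that is outside N[S].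
  accounted⇔window : ∀ S v → Accounted (C n) S v ⇔ (centredWindow S v ≡ true)
  accounted⇔window S v = mk⇔ accounted⇒window window⇒accounted
    where
    bit : Fin n → Bool
    bit = lookup S

    Case : Set
    Case = WindowCase (bit (prev (prev v))) (bit (prev v)) (bit v) (bit (next v)) (bit (next (next v)))

    complete : Case → centredWindow S v ≡ true
    complete = window-complete

    accounted⇒window : Accounted (C n) S v → centredWindow S v ≡ true
    accounted⇒window (inj₁ v∈S) = complete (centre ([]=⇒lookup v∈S))
    accounted⇒window (inj₂ (u , u∈N[v] , u∉N[S]))
      with N[ v ]-cases u∈N[v] | to (uncovered⇔ S u) u∉N[S]
    ... | inj₁ refl        | p , c , nx = complete
      (left p c (subst (λ w → bit w ≡ false) (next-prev v) nx))
    ... | inj₂ (inj₁ refl) | p , c , nx = complete (middle p c nx)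
    ... | inj₂ (inj₂ refl) | p , c , nx = complete
      (right (subst (λ w → bit w ≡ false) (prev-next v) p) c nx)

    window⇒accounted : centredWindow S v ≡ true → Accounted (C n) S v
    window⇒accounted good with window-sound _ _ _ _ _ good
    ... | centre c    = inj₁ (lookup⇒[]= v S c)
    ... | left p c nx = inj₂ (prev v , prev∈N v , from (uncovered⇔ S (prev v))
      (p , c , subst (λ w → bit w ≡ false) (sym (next-prev v)) nx))
    ... | middle p c nx = inj₂ (v , inj₁ refl , from (uncovered⇔ S v) (p , c , nx))
    ... | right p c nx  = inj₂ (next v , next∈N v , from (uncovered⇔ S (next v))
      (subst (λ w → bit w ≡ false) (sym (prev-next v)) p , c , nx))

  at : Subset n → ℕ → Bool
  at S j = lookup S (pos j)

  centredWindow-pos : ∀ S j → centredWindow S (pos (2 + j)) ≡ windowAt (at S) j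
  centredWindow-pos S j = window-cong
    (cong (lookup S) (trans (cong prev (prev-pos (1 + j))) (prev-pos j)))
    (cong (lookup S) (prev-pos (1 + j)))
    (refl {x = at S (2 + j)})
    (cong (lookup S) (next-pos (2 + j)))
    (cong (lookup S) (trans (cong next (next-pos (2 + j))) (next-pos (3 + j))))

  centre-of : ∀ v → pos (2 + toℕ (prev (prev v))) ≡ v
  centre-of v = begin
    pos (2 + toℕ w)        ≡⟨ next-pos (1 + toℕ w) ⟨
    next (pos (1 + toℕ w)) ≡⟨ cong next (next-pos (toℕ w)) ⟨
    next (next (pos (toℕ w))) ≡⟨ cong (next ∘ next) (pos-toℕ w) ⟩
    next (next w)          ≡⟨ cong next (next-prev (prev v)) ⟩
    next (prev v)          ≡⟨ next-prev v ⟩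
    v ∎
    where open ≡-Reasoning
          w = prev (prev v)

  convex⇔windows : ∀ S → DigitallyConvex (C n) S ⇔ (∀ j → j < n → windowAt (at S) j ≡ true)
  convex⇔windows S = ⇔.trans (convex⇔accounted (C n) S) (mk⇔
    (λ accounted j _ → trans (sym (centredWindow-pos S j))
                             (to (accounted⇔window S (pos (2 + j))) (accounted (pos (2 + j)))))
    (λ good v → from (accounted⇔window S v)
      (subst (λ w → centredWindow S w ≡ true) (centre-of v)
        (trans (centredWindow-pos S _) (good _ (toℕ<n (prev (prev v))))))))

  entry-toList-at : ∀ S i → i < n → entry (toList S) i ≡ at S i
  entry-toList-at S i i<n = trans (entry-toList S i i<n) (cong (lookup S) (toℕ-injective
    (trans (toℕ-fromℕ< i<n) (sym (trans (toℕ-pos i) (m<n⇒m%n≡m i<n))))))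

  wrapped-entry : ∀ S ys → (∀ t → t < 4 → entry ys t ≡ at S t) →
                  ∀ i → i < 4 + n → entry (toList S ++ ys) i ≡ at S i
  wrapped-entry S ys prefix i i<4+n with i <? n
  ... | yes i<n = trans (entry-++ˡ (toList S) ys i (subst (i <_) (sym (length-toList S)) i<n))
                        (entry-toList-at S i i<n)
  ... | no i≮n with m≤n⇒∃[o]m+o≡n (≮⇒≥ i≮n)
  ...   | t , refl = begin
    entry (toList S ++ ys) (n + t)                  ≡⟨ cong (λ l → entry (toList S ++ ys) (l + t)) (length-toList S) ⟨
    entry (toList S ++ ys) (length (toList S) + t)  ≡⟨ entry-++ʳ (toList S) ys t ⟩
    entry ys t                                      ≡⟨ prefix t (+-cancelˡ-< n t 4 (subst (n + t <_) (+-comm 4 n) i<4+n)) ⟩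
    at S t                                          ≡⟨ cong (lookup S) (pos-wrap t) ⟨
    at S (n + t)                                    ∎
    where open ≡-Reasoning

  cyclic-word : ∀ S ys → length ys ≡ 4 → (∀ t → t < 4 → entry ys t ≡ at S t) →
                (∀ j → j < n → windowAt (at S) j ≡ true) ⇔ (allWindows (toList S ++ ys) ≡ true)
  cyclic-word S ys |ys|≡4 prefix = mk⇔
    (λ good → allWindows-complete L (λ j fits → trans (same j (inside fits)) (good j (inside fits))))
    (λ all j j<n → trans (sym (same j j<n)) (allWindows-sound L all j (fits j<n)))
    where
    L = toList S ++ ys
    |L| : length L ≡ 4 + n
    |L| = trans (length-++ (toList S)) (trans (cong₂ _+_ (length-toList S) |ys|≡4) (+-comm n 4))
    inside : ∀ {j} → 5 + j ≤ length L → j < n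
    inside {j} fits = +-cancelˡ-≤ 4 (suc j) n (subst (5 + j ≤_) |L| fits)
    fits : ∀ {j} → j < n → 5 + j ≤ length L
    fits {j} j<n = subst (5 + j ≤_) (sym |L|) (+-monoʳ-≤ 4 j<n)
    same : ∀ j → j < n → windowAt (entry L) j ≡ windowAt (at S) j
    same j j<n = windowAt-cong {entry L} {at S} j (λ i i≤4 → wrapped-entry S ys prefix (i + j) (+-mono-≤-< i≤4 j<n))

T : ℕ → Vec Bool 4 → Vec Bool 4 → ℕ
T m q z = Σᵛ m (λ R → 𝟙 (allWindows (toList q ++ toList R ++ toList z)))

T-step : ∀ m a b c d z →
         T (suc m) (a ∷ b ∷ c ∷ d ∷ []) z ≡
           𝟙 (window a b c d true)  * T m (b ∷ c ∷ d ∷ true ∷ []) z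
         + 𝟙 (window a b c d false) * T m (b ∷ c ∷ d ∷ false ∷ []) z
T-step m a b c d z = cong₂ _+_ (extend true) (extend false)
  where
  rest : Bool → Vec Bool m → Bool
  rest x R = allWindows (b ∷ c ∷ d ∷ x ∷ toList R ++ toList z)
  extend : ∀ x → Σᵛ m (λ R → 𝟙 (window a b c d x ∧ rest x R))
                 ≡ 𝟙 (window a b c d x) * T m (b ∷ c ∷ d ∷ x ∷ []) z
  extend x = trans (Σᵛ-cong m (λ R → 𝟙-∧ (window a b c d x) (rest x R)))
                   (Σᵛ-*ˡ m (𝟙 (window a b c d x)) (λ R → 𝟙 (rest x R)))

allVectors? : ∀ k {P : Vec Bool k → Set} → (∀ v → Dec (P v)) → Dec (∀ v → P v)
allVectors? zero    P? = map′ (λ p → λ { [] → p }) (λ all → all []) (P? [])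
allVectors? (suc k) P? =
  map′ (λ { (t , f) → λ { (true ∷ v) → t v ; (false ∷ v) → f v } })
       (λ all → (λ v → all (true ∷ v)) , (λ v → all (false ∷ v)))
       (allVectors? k (λ v → P? (true ∷ v)) ×-dec allVectors? k (λ v → P? (false ∷ v)))

T-base : ∀ q z → Step (λ m → T m q z) 0
T-base = from-yes (allVectors? 4 λ q → allVectors? 4 λ z → T 4 q z + T 2 q z ≟ 2 * T 3 q z + T 0 q z)

T-rec : ∀ j q z → Step (λ m → T m q z) j
T-rec zero    q                        z = T-base q z
T-rec (suc j) (a ∷ b ∷ c ∷ d ∷ []) z =
  step-ext (λ m → T (suc m) (a ∷ b ∷ c ∷ d ∷ []) z) (λ m → weighted true m + weighted false m) j
    (λ m → T-step m a b c d z)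
    (step-+ (weighted true) (weighted false) j (weighted-rec true) (weighted-rec false))
  where
  shifted : Bool → Vec Bool 4
  shifted x = b ∷ c ∷ d ∷ x ∷ []
  weighted : Bool → ℕ → ℕ
  weighted x m = 𝟙 (window a b c d x) * T m (shifted x) z
  weighted-rec : ∀ x → Step (weighted x) j
  weighted-rec x = step-* (𝟙 (window a b c d x)) (λ m → T m (shifted x) z) j (T-rec j (shifted x) z)

cycle-convex⇔word : ∀ m (q : Vec Bool 4) (R : Vec Bool m) →
  DigitallyConvex (C (4 + m)) (q ++ᵛ R) ⇔ (allWindows (toList q ++ toList R ++ toList q) ≡ true)
cycle-convex⇔word m q R = subst (λ L → DigitallyConvex (C (4 + m)) S ⇔ (allWindows L ≡ true)) word
  (⇔.trans (convex⇔windows S) (cyclic-word S (toList q) (length-toList q) prefix))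
  where
  open Cycle (3 + m)
  S = q ++ᵛ R
  word : toList S ++ toList q ≡ toList q ++ toList R ++ toList q
  word = trans (cong (_++ toList q) (toList-++ q R)) (++-assoc (toList q) (toList R) (toList q))
  prefix : ∀ t → t < 4 → entry (toList q) t ≡ at S t
  prefix t t<4 = begin
    entry (toList q) t                ≡⟨ entry-++ˡ (toList q) (toList R) t (subst (t <_) (sym (length-toList q)) t<4) ⟨
    entry (toList q ++ toList R) t    ≡⟨ cong (λ L → entry L t) (toList-++ q R) ⟨
    entry (toList S) t                ≡⟨ entry-toList-at S t (≤-trans t<4 (m≤m+n 4 m)) ⟩
    at S t                            ∎
    where open ≡-Reasoning

nD-cycle : ∀ m → nD (C (4 + m)) ≡ Σᵛ 4 (λ q → T m q q)
nD-cycle m = begin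
  nD (C (4 + m))                                           ≡⟨ count-convex (C (4 + m)) ⟩
  Σᵛ (4 + m) (λ S → 𝟙 (does (convex? S)))                 ≡⟨ Σᵛ-++ 4 m (λ S → 𝟙 (does (convex? S))) ⟩
  Σᵛ 4 (λ q → Σᵛ m (λ R → 𝟙 (does (convex? (q ++ᵛ R))))) ≡⟨ Σᵛ-cong 4 (λ q → Σᵛ-cong m (λ R →
                                                               cong 𝟙 (does-≡ (convex? (q ++ᵛ R)) (cycle-convex⇔word m q R)))) ⟩
  Σᵛ 4 (λ q → T m q q)                                     ∎
  where open ≡-Reasoning
        convex? = digitallyConvex? (C (4 + m))

nD-step : ∀ j → Step (λ m → nD (C (4 + m))) j
nD-step j = step-ext (λ m → nD (C (4 + m))) (λ m → Σᵛ 4 (λ q → T m q q)) j nD-cycle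
  (step-Σᵛ 4 (λ q m → T m q q) j (λ q → T-rec j q q))

-- The steps, restated in terms of n ≥ 8.  Stated for an arbitrary g so that
-- identifying n with 8 + j only compares arguments of g and never evaluates g.
recurrence-from-steps : ∀ (g : ℕ → ℕ) → (∀ j → Step (λ m → g (4 + m)) j) →
                        ∀ n → 8 ≤ n → g n + g (n ∸ 2) ≡ 2 * g (n ∸ 1) + g (n ∸ 4)
recurrence-from-steps g steps n 8≤n with m≤n⇒∃[o]m+o≡n 8≤n
... | j , refl = steps j

mainTheorem3 : (nD (C 3) ≡ 2) × (nD (C 4) ≡ 6) × (nD (C 5) ≡ 12) × (nD (C 6) ≡ 20)
    × ((n : ℕ) → n ≥ 7 → nD (C n) + nD (C (n ∸ 2)) ≡ 2 * nD (C (n ∸ 1)) + nD (C (n ∸ 4)))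
mainTheorem3 = refl , refl , refl , refl , recurrence
  where
  recurrence : (n : ℕ) → n ≥ 7 → nD (C n) + nD (C (n ∸ 2)) ≡ 2 * nD (C (n ∸ 1)) + nD (C (n ∸ 4))
  recurrence n n≥7 with m≤n⇒m<n∨m≡n n≥7
  ... | inj₁ 8≤n  = recurrence-from-steps (λ n → nD (C n)) nD-step n 8≤n
  ... | inj₂ refl = refl
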